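{- For any real number $k\ge2$, writing $K=\lfloor k\rfloor+1$, we have $2K\le D_2(k)\le K^2$.
   Context: For $\mathbf{x}=(x_1,\dots,x_d)\in\mathbb{Z}_{>0}^d$ and $K=\lfloor k\rfloor+1$, let $a_K(\mathbf{x})=d+|\{i:x_i<K\}|$, $b_K(\mathbf{x})=1+\sum_{i:x_i<K}1/x_i$, $\mathrm{aad}^*_K(\mathbf{x})=a_K(\mathbf{x})/b_K(\mathbf{x})$. $D_2(k)$ is the minimum integer $z$ such that there exist an integer $d\ge K$ and a tuple $\mathbf{x}\in\mathbb{Z}_{\ge2}^d$ with $\sum_i x_i=z$ and $\mathrm{aad}^*_K(\mathbf{x})>k$. -}

module Defs where

open import Data.Nat as ℕ using (ℕ; zero; suc; _<_; _<?_)
open import Data.Integer using (+_)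
open import Data.Rational as ℚ using (ℚ; 0ℚ; 1ℚ; _≟_; ≢-nonZero)
open import Data.List using (List; []; _∷_; length)
open import Data.Product using (Σ; ∃; _×_; _,_)
open import Data.Sum using (_⊎_)
open import Data.Empty using (⊥)
open import Data.Unit using (⊤)
open import Relation.Binary.PropositionalEquality using (_≡_)
open import Relation.Nullary using (¬_; yes; no)

-- Real numbers as (two-sided, located) Dedekind cuts of ℚ.
-- L = rationals strictly below the real, U = rationals strictly above.

record ℝ : Set₁ where
  field
    L U        : ℚ → Set
    L-inhabited : ∃ λ q → L q
    U-inhabited : ∃ λ q → U q
    L-rounded  : ∀ q → L q → ∃ λ r → (q ℚ.< r) × L r
    L-lower    : ∀ q r → r ℚ.< q → L q → L r
    U-rounded  : ∀ q → U q → ∃ λ r → (r ℚ.< q) × U r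
    U-upper    : ∀ q r → q ℚ.< r → U q → U r
    disjoint   : ∀ q → ¬ (L q × U q)
    located    : ∀ q r → q ℚ.< r → L q ⊎ U r
open ℝ public

ℕ→ℚ : ℕ → ℚ
ℕ→ℚ n = (+ n) ℚ./ 1

_>ℝ_ : ℚ → ℝ → Set
q >ℝ k = U k q

_≥ℝ_ : ℝ → ℚ → Set
k ≥ℝ q = ¬ (U k q)

-- "K = ⌊k⌋ + 1" for natural K:  K - 1 ≤ k < K
IsFloorSucc : ℝ → ℕ → Set
IsFloorSucc k K = (ℕ→ℚ K >ℝ k) × (k ≥ℝ ℕ→ℚ (K ℕ.∸ 1))

-- 1/x as a rational (x is always ≥ 1 where this is used; value at 0 is irrelevant)
recip : ℕ → ℚ
recip zero    = 0ℚ
recip (suc n) = (+ 1) ℚ./ suc n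

countBelow : ℕ → List ℕ → ℕ
countBelow K [] = 0
countBelow K (x ∷ xs) with x <? K
... | yes _ = suc (countBelow K xs)
... | no  _ = countBelow K xs

recipSumBelow : ℕ → List ℕ → ℚ
recipSumBelow K [] = 0ℚ
recipSumBelow K (x ∷ xs) with x <? K
... | yes _ = recip x ℚ.+ recipSumBelow K xs
... | no  _ = recipSumBelow K xs

a : ℕ → List ℕ → ℕ
a K x = length x ℕ.+ countBelow K x

b : ℕ → List ℕ → ℚ
b K x = 1ℚ ℚ.+ recipSumBelow K x

-- total division (the divisor b_K(x) ≥ 1 is never 0 here)
_div_ : ℚ → ℚ → ℚ
p div q with q ≟ 0ℚ
... | yes _ = 0ℚ
... | no q≢0 = ℚ._÷_ p q {{≢-nonZero q≢0}}

aad* : ℕ → List ℕ → ℚ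
aad* K x = ℕ→ℚ (a K x) div b K x

AllGe2 : List ℕ → Set
AllGe2 [] = ⊤
AllGe2 (x ∷ xs) = (2 ℕ.≤ x) × AllGe2 xs

sumℕ : List ℕ → ℕ
sumℕ [] = 0
sumℕ (x ∷ xs) = x ℕ.+ sumℕ xs

-- z is attained: there exist d ≥ K and x ∈ ℤ_{≥2}^d with Σ x_i = z and aad*_K(x) > k.
-- (K is supplied together with the proof that K = ⌊k⌋+1.)
Attained : ℝ → ℕ → ℕ → Set
Attained k K z = Σ (List ℕ) λ x →
  (K ℕ.≤ length x) × AllGe2 x × (sumℕ x ≡ z) × (aad* K x >ℝ k)

-- D₂(k) = min { z | Attained k K z }.  The bounds  lo ≤ D₂(k) ≤ hi  mean:
-- some attained z is ≤ hi (so the minimum exists and is ≤ hi),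
-- and every attained z is ≥ lo.
D₂-bounds : ℝ → ℕ → ℕ → ℕ → Set
D₂-bounds k K lo hi =
  (∃ λ z → Attained k K z × (z ℕ.≤ hi)) × (∀ z → Attained k K z → lo ℕ.≤ z)

module Submission where

-- The constant tuple (K, …, K) of length K has no entry below K, so a_K = K and b_K = 1;
-- hence aad*_K = K > k and D₂(k) ≤ K². Conversely an attaining tuple has d ≥ K entries,
-- each at least 2, so its sum is at least 2K.

open import Defs
open import Data.Nat as ℕ using (ℕ; zero; suc; _+_; _*_; _<?_; _≤_; z≤n; s≤s)
import Data.Nat.Properties as ℕ
open import Data.Rational as ℚ using (0ℚ; 1ℚ; _≟_)
import Data.Rational.Properties as ℚ
open import Data.List using ([]; _∷_; length; replicate)
open import Data.List.Properties using (length-replicate)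
open import Data.List.Relation.Unary.All using (All; []; _∷_)
open import Data.List.Relation.Unary.All.Properties using (replicate⁺)
open import Data.Product using (_,_; proj₁)
open import Data.Unit using (tt)
open import Data.Empty using (⊥-elim)
open import Relation.Nullary using (yes; no)
open import Relation.Nullary.Decidable using (toWitness)
open import Relation.Binary.PropositionalEquality
  using (_≡_; refl; sym; cong; cong₂; subst; module ≡-Reasoning)

countBelow-all≥ : ∀ {K xs} → All (K ≤_) xs → countBelow K xs ≡ 0
countBelow-all≥ [] = refl
countBelow-all≥ {K} {x ∷ _} (K≤x ∷ K≤xs) with x <? K
... | yes x<K = ⊥-elim (ℕ.≤⇒≯ K≤x x<K)
... | no  _   = countBelow-all≥ K≤xs

recipSumBelow-all≥ : ∀ {K xs} → All (K ≤_) xs → recipSumBelow K xs ≡ 0ℚ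
recipSumBelow-all≥ [] = refl
recipSumBelow-all≥ {K} {x ∷ _} (K≤x ∷ K≤xs) with x <? K
... | yes x<K = ⊥-elim (ℕ.≤⇒≯ K≤x x<K)
... | no  _   = recipSumBelow-all≥ K≤xs

div-identityʳ : ∀ p → p div 1ℚ ≡ p
div-identityʳ p with 1ℚ ≟ 0ℚ
... | no _ = ℚ.*-identityʳ p

aad*-all≥ : ∀ {K xs} → All (K ≤_) xs → aad* K xs ≡ ℕ→ℚ (length xs)
aad*-all≥ {K} {xs} K≤xs = begin
  ℕ→ℚ (length xs + countBelow K xs) div (1ℚ ℚ.+ recipSumBelow K xs)
    ≡⟨ cong₂ _div_ (cong (λ c → ℕ→ℚ (length xs + c)) (countBelow-all≥ K≤xs))
                 (cong (1ℚ ℚ.+_) (recipSumBelow-all≥ K≤xs)) ⟩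
  ℕ→ℚ (length xs + 0) div (1ℚ ℚ.+ 0ℚ)
    ≡⟨ cong (λ n → ℕ→ℚ n div 1ℚ) (ℕ.+-identityʳ (length xs)) ⟩
  ℕ→ℚ (length xs) div 1ℚ
    ≡⟨ div-identityʳ (ℕ→ℚ (length xs)) ⟩
  ℕ→ℚ (length xs) ∎
  where open ≡-Reasoning

sumℕ-replicate : ∀ n m → sumℕ (replicate n m) ≡ n * m
sumℕ-replicate zero    m = refl
sumℕ-replicate (suc n) m = cong (m +_) (sumℕ-replicate n m)

AllGe2-replicate : ∀ n {m} → 2 ≤ m → AllGe2 (replicate n m)
AllGe2-replicate zero    _   = tt
AllGe2-replicate (suc n) 2≤m = 2≤m , AllGe2-replicate n 2≤m

AllGe2⇒2*length≤sumℕ : ∀ xs → AllGe2 xs → 2 * length xs ≤ sumℕ xs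
AllGe2⇒2*length≤sumℕ []       _            = z≤n
AllGe2⇒2*length≤sumℕ (x ∷ xs) (2≤x , 2≤xs) = begin
  2 * suc (length xs)  ≡⟨ ℕ.*-suc 2 (length xs) ⟩
  2 + 2 * length xs    ≤⟨ ℕ.+-mono-≤ 2≤x (AllGe2⇒2*length≤sumℕ xs 2≤xs) ⟩
  x + sumℕ xs          ∎
  where open ℕ.≤-Reasoning

-- For K ≤ 1 the rational K < 2 would already lie above k; the comparison is decided by computation.
floorSucc-≥2 : ∀ k → k ≥ℝ ℕ→ℚ 2 → ∀ K → IsFloorSucc k K → 2 ≤ K
floorSucc-≥2 k k≥2 zero (K>k , _) =
  ⊥-elim (k≥2 (U-upper k _ _ (toWitness {a? = ℕ→ℚ 0 ℚ.<? ℕ→ℚ 2} tt) K>k))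
floorSucc-≥2 k k≥2 (suc zero) (K>k , _) =
  ⊥-elim (k≥2 (U-upper k _ _ (toWitness {a? = ℕ→ℚ 1 ℚ.<? ℕ→ℚ 2} tt) K>k))
floorSucc-≥2 k k≥2 (suc (suc K)) _ = s≤s (s≤s z≤n)

attained-K*K : ∀ k K → 2 ≤ K → ℕ→ℚ K >ℝ k → Attained k K (K * K)
attained-K*K k K 2≤K K>k =
  replicate K K
  , ℕ.≤-reflexive (sym (length-replicate K))
  , AllGe2-replicate K 2≤K
  , sumℕ-replicate K K
  , subst (U k) (sym aad*≡K) K>k
  where
  aad*≡K : aad* K (replicate K K) ≡ ℕ→ℚ K
  aad*≡K = subst (λ d → aad* K (replicate K K) ≡ ℕ→ℚ d) (length-replicate K)
                 (aad*-all≥ (replicate⁺ K ℕ.≤-refl))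

attained⇒2K≤ : ∀ k K z → Attained k K z → 2 * K ≤ z
attained⇒2K≤ k K z (xs , K≤d , 2≤xs , sum≡z , _) =
  subst (2 * K ≤_) sum≡z
    (ℕ.≤-trans (ℕ.*-monoʳ-≤ 2 K≤d) (AllGe2⇒2*length≤sumℕ xs 2≤xs))

corollary12 : (k : ℝ) → k ≥ℝ ℕ→ℚ 2 → (K : ℕ) → IsFloorSucc k K →
    D₂-bounds k K (2 * K) (K * K)
corollary12 k k≥2 K K=⌊k⌋+1 =
    (K * K , attained-K*K k K (floorSucc-≥2 k k≥2 K K=⌊k⌋+1) (proj₁ K=⌊k⌋+1) , ℕ.≤-refl)
  , attained⇒2K≤ k K
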